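{- Let $m \geq 2$ be an integer, let $C = \mathrm{rad}(m)$, and let $k \geq 2$ be an integer. If $m \geq C^{2k-2}$, then for every real $x$ with $C^{k-1} \leq x \leq m/C^{k-1}$, $m$ has a $k$-powerful divisor $d$ with $x \leq d \leq Cx$.
   Context: $\mathrm{rad}(m)$ is the product of the distinct primes dividing $m$. A positive integer $d$ is $k$-powerful if every prime $p \mid d$ satisfies $p^k \mid d$.
   Formalization: The variable x ranges over ℚ rather than over the reals. -}

module Defs where

open import Data.Nat using (ℕ; suc; _^_)
open import Data.Nat.Divisibility using (_∣_; _∣?_)
open import Data.Nat.Primality using (Prime; prime?)
open import Data.List using (List; filter; upTo)
open import Data.Nat.ListAction using (product)
open import Data.Integer using (+_)
open import Data.Rational using (ℚ; _/_)
open import Relation.Nullary.Decidable using (_×-dec_)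

-- The primes dividing m, listed without repetition (all such primes are ≤ m
-- when m ≥ 1).
primeDivisors : ℕ → List ℕ
primeDivisors m = filter (λ p → prime? p ×-dec p ∣? m) (upTo (suc m))

rad : ℕ → ℕ
rad m = product (primeDivisors m)

KPowerful : ℕ → ℕ → Set
KPowerful k d = ∀ p → Prime p → p ∣ d → p ^ k ∣ d

toℚ : ℕ → ℚ
toℚ n = (+ n) / 1

-- Write m = D * e with D k-powerful and e k-th-power-free. Every prime power dividing e has
-- exponent below k and its prime divides C, so e ∣ C^(k-1) and D ≥ m / C^(k-1) ≥ x. Then descend:
-- while d > C x and some p^(k+1) divides d, pass to d / p, which is still k-powerful and, as
-- p ≤ C, still exceeds x. Once no p^(k+1) divides d, d ∣ C^k and so d ≤ C * C^(k-1) ≤ C x.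
module Submission where

open import Defs
open import Data.Nat using (ℕ; _^_; _∸_; _≤_; _*_)
open import Data.Nat.Divisibility using (_∣_)
open import Data.Product using (∃-syntax; _×_)
open import Data.Rational using (ℚ) renaming (_≤_ to _≤ℚ_; _*_ to _*ℚ_)

open import Data.Nat.Base
  using (zero; suc; _<_; z≤n; s≤s; NonZero; NonTrivial; ≢-nonZero; ≢-nonZero⁻¹; >-nonZero; nonTrivial⇒≢1)
open import Data.Nat.Properties
  using (_≟_; _≤?_; ≰⇒>; ≤-trans; *-identityˡ; *-identityʳ; *-comm; *-assoc; m^n≢0; n≢0∧m>1⇒m*n>1; anyUpTo?)
open import Data.Nat.Divisibility
  using (_∤_; divides; quotient; quotient-∣; quotient-<; quotient≢0; m∣n⇒n≡m*quotient; ∣⇒≤; 0∣⇒≡0; ∣1⇒≡1; 1∣_; _∣?_;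
         ∣-refl; ∣-trans; m∣m*n; ∣m⇒∣m*n; ∣n⇒∣m*n; *-pres-∣; *-monoʳ-∣; *-cancelˡ-∣)
open import Data.Nat.Coprimality using (Coprime; coprime-divisor)
import Data.Nat.Coprimality as Coprimality
open import Data.Nat.Primality
  using (Prime; prime?; prime⇒nonZero; prime⇒nonTrivial; prime⇒irreducible; euclidsLemma; productOfPrimes≢0)
open import Data.Nat.Primality.Factorisation using (factorise; PrimeFactorisation)
open import Data.Nat.ListAction using (product)
open import Data.Nat.ListAction.Properties using (∈⇒∣product)
open import Data.Nat.Induction using (<-wellFounded)
open import Induction.WellFounded using (Acc; acc)
open import Data.List using ([]; _∷_; upTo)
open import Data.List.Relation.Unary.All as All using (All; []; _∷_)
open import Data.List.Relation.Unary.All.Properties using (all-filter)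
open import Data.List.Membership.Propositional.Properties using (∈-filter⁺; ∈-upTo⁺)
open import Data.Integer using (+_; +≤+)
import Data.Integer.Properties as ℤ
import Data.Rational as ℚ
import Data.Rational.Properties as ℚ
open import Data.Product using (∃₂; _,_; proj₁)
open import Data.Sum using (_⊎_; inj₁; inj₂)
open import Function using (_∘_)
open import Relation.Nullary using (yes; no; contradiction)
open import Relation.Nullary.Decidable using (_×-dec_)
open import Relation.Binary.PropositionalEquality using (_≡_; _≢_; refl; sym; trans; cong; cong₂; subst; subst₂)

prime≢1 : ∀ {p} → Prime p → p ≢ 1
prime≢1 pp = nonTrivial⇒≢1 {{prime⇒nonTrivial pp}}

prime∣prime⇒≡ : ∀ {p q} → Prime p → Prime q → p ∣ q → p ≡ q
prime∣prime⇒≡ pp pq p∣q with prime⇒irreducible pq p∣q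
... | inj₁ p≡1 = contradiction p≡1 (prime≢1 pp)
... | inj₂ p≡q = p≡q

prime∣^⇒∣ : ∀ {p q} j → Prime p → p ∣ q ^ j → p ∣ q
prime∣^⇒∣ zero    pp p∣1 = contradiction (∣1⇒≡1 p∣1) (prime≢1 pp)
prime∣^⇒∣ {q = q} (suc j) pp p∣q^j+1 with euclidsLemma q (q ^ j) pp p∣q^j+1
... | inj₁ p∣q   = p∣q
... | inj₂ p∣q^j = prime∣^⇒∣ j pp p∣q^j

prime∣prime^⇒≡ : ∀ {p q} j → Prime p → Prime q → p ∣ q ^ j → p ≡ q
prime∣prime^⇒≡ j pp pq p∣q^j = prime∣prime⇒≡ pp pq (prime∣^⇒∣ j pp p∣q^j)

prime∤⇒coprime : ∀ {p n} → Prime p → p ∤ n → Coprime n p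
prime∤⇒coprime pp p∤n (i∣n , i∣p) with prime⇒irreducible pp i∣p
... | inj₁ i≡1 = i≡1
... | inj₂ refl = contradiction i∣n p∤n

q^j∣p*n⇒q^j∣n : ∀ {p q n} j → Prime p → Prime q → q ≢ p → q ^ j ∣ p * n → q ^ j ∣ n
q^j∣p*n⇒q^j∣n j pp pq q≢p =
  coprime-divisor (prime∤⇒coprime pp λ p∣q^j → q≢p (sym (prime∣prime^⇒≡ j pp pq p∣q^j)))

prime^-nonTrivial : ∀ {p} j → Prime p → NonTrivial (p ^ suc j)
prime^-nonTrivial {p} j pp =
  n≢0∧m>1⇒m*n>1 p (p ^ j) {{m^n≢0 p j {{prime⇒nonZero pp}}}} {{prime⇒nonTrivial pp}}

divisor≢0 : ∀ {m n} .{{_ : NonZero n}} → m ∣ n → NonZero m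
divisor≢0 {n = n} m∣n = ≢-nonZero λ { refl → ≢-nonZero⁻¹ n (0∣⇒≡0 m∣n) }

^-monoˡ-∣ : ∀ {m n} j → m ∣ n → m ^ j ∣ n ^ j
^-monoˡ-∣ zero    m∣n = ∣-refl
^-monoˡ-∣ (suc j) m∣n = *-pres-∣ m∣n (^-monoˡ-∣ j m∣n)

^-monoʳ-∣ : ∀ m {i j} → i ≤ j → m ^ i ∣ m ^ j
^-monoʳ-∣ m z≤n       = 1∣ _
^-monoʳ-∣ m (s≤s i≤j) = *-monoʳ-∣ m (^-monoʳ-∣ m i≤j)

∣-byPrimePowers : ∀ {a b} .{{_ : NonZero a}} → (∀ p j → Prime p → p ^ j ∣ a → p ^ j ∣ b) → a ∣ b
∣-byPrimePowers {a} prime^∣ = subst (_∣ _) (sym isFactorisation)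
  (product∣ factors factorsPrime λ p j pp → prime^∣ p j pp ∘ subst (_ ∣_) (sym isFactorisation))
  where
  open PrimeFactorisation (factorise a)

  product∣ : ∀ {b} ps → All Prime ps →
             (∀ q j → Prime q → q ^ j ∣ product ps → q ^ j ∣ b) → product ps ∣ b
  product∣ []       _          _       = 1∣ _
  product∣ {b} (p ∷ ps) (pp ∷ pps) prime^∣ =
    subst (p * product ps ∣_) (sym b≡p*b′) (*-monoʳ-∣ p (product∣ ps pps prime^∣b′))
    where
    p∣b : p ∣ b
    p∣b = subst (_∣ b) (*-identityʳ p) (prime^∣ p 1 pp (*-monoʳ-∣ p (1∣ _)))
    b′ = quotient p∣b
    b≡p*b′ : b ≡ p * b′
    b≡p*b′ = m∣n⇒n≡m*quotient p∣b
    prime^∣b′ : ∀ q j → Prime q → q ^ j ∣ product ps → q ^ j ∣ b′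
    prime^∣b′ q j pq q^j∣ps with q ≟ p
    ... | yes refl =
      *-cancelˡ-∣ q {{prime⇒nonZero pq}} (subst (_ ∣_) b≡p*b′ (prime^∣ q (suc j) pq (*-monoʳ-∣ q q^j∣ps)))
    ... | no q≢p  =
      q^j∣p*n⇒q^j∣n j pp pq q≢p (subst (_ ∣_) b≡p*b′ (prime^∣ q j pq (∣n⇒∣m*n p q^j∣ps)))

kPowerful[1] : ∀ k → KPowerful k 1
kPowerful[1] k p pp p∣1 = contradiction (∣1⇒≡1 p∣1) (prime≢1 pp)

kPowerful-prime^ : ∀ {p} k → Prime p → KPowerful k (p ^ k)
kPowerful-prime^ k pp q pq q∣p^k with prime∣prime^⇒≡ k pq pp q∣p^k
... | refl = ∣-refl

kPowerful-* : ∀ {k a b} → KPowerful k a → KPowerful k b → KPowerful k (a * b)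
kPowerful-* {a = a} {b} kPa kPb q pq q∣ab with euclidsLemma a b pq q∣ab
... | inj₁ q∣a = ∣m⇒∣m*n b (kPa q pq q∣a)
... | inj₂ q∣b = ∣n⇒∣m*n a (kPb q pq q∣b)

kPowerful-cancelˡ : ∀ {k p n} → Prime p → p ^ suc k ∣ p * n → KPowerful k (p * n) → KPowerful k n
kPowerful-cancelˡ {k} {p} pp p^k+1∣pn kPpn q pq q∣n with q ≟ p
... | yes refl = *-cancelˡ-∣ p {{prime⇒nonZero pp}} p^k+1∣pn
... | no q≢p  = q^j∣p*n⇒q^j∣n k pp pq q≢p (kPpn q pq (∣n⇒∣m*n p q∣n))

PowerFree : ℕ → ℕ → Set
PowerFree r n = ∀ p → Prime p → p ^ r ∤ n

primePower∣⊎powerFree : ∀ r n .{{_ : NonZero n}} →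
                        (∃[ p ] Prime p × p ^ suc r ∣ n) ⊎ PowerFree (suc r) n
primePower∣⊎powerFree r n with anyUpTo? (λ p → prime? p ×-dec p ^ suc r ∣? n) (suc n)
... | yes (p , _ , p^r+1∣n) = inj₁ (p , p^r+1∣n)
... | no ∄p^r+1∣n = inj₂ λ p pp p^r+1∣n →
  ∄p^r+1∣n (p , s≤s (∣⇒≤ (∣-trans (m∣m*n (p ^ r)) p^r+1∣n)) , pp , p^r+1∣n)

powerFree⇒∣^ : ∀ {n c} j .{{_ : NonZero n}} → PowerFree (suc j) n →
               (∀ p → Prime p → p ∣ n → p ∣ c) → n ∣ c ^ j
powerFree⇒∣^ {n} {c} j free primes∣c = ∣-byPrimePowers prime^∣c^j
  where
  prime^∣c^j : ∀ p i → Prime p → p ^ i ∣ n → p ^ i ∣ c ^ j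
  prime^∣c^j p zero      _  _     = 1∣ _
  prime^∣c^j p (suc i) pp p^i+1∣n with suc i ≤? j
  ... | yes i+1≤j =
    ∣-trans (^-monoˡ-∣ (suc i) (primes∣c p pp (∣-trans (m∣m*n (p ^ i)) p^i+1∣n))) (^-monoʳ-∣ c i+1≤j)
  ... | no i+1≰j  = contradiction (∣-trans (^-monoʳ-∣ p (≰⇒> i+1≰j)) p^i+1∣n) (free p pp)

PowerfulFactorisation : ℕ → ℕ → Set
PowerfulFactorisation k n = ∃₂ λ D e → n ≡ D * e × KPowerful k D × PowerFree k e

powerfulFactorisation-prime^* : ∀ {k p n} → Prime p →
                                PowerfulFactorisation k n → PowerfulFactorisation k (p ^ k * n)
powerfulFactorisation-prime^* {k} {p} pp (D , e , n≡De , kPD , free) =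
  p ^ k * D , e , trans (cong (p ^ k *_) n≡De) (sym (*-assoc (p ^ k) D e)) ,
  kPowerful-* {k} (kPowerful-prime^ k pp) kPD , free

powerfulFactorisation : ∀ j n .{{_ : NonZero n}} → PowerfulFactorisation (suc j) n
powerfulFactorisation j n = go n (<-wellFounded n)
  where
  go : ∀ n .{{_ : NonZero n}} → Acc _<_ n → PowerfulFactorisation (suc j) n
  go n (acc smaller) with primePower∣⊎powerFree j n
  ... | inj₂ free = 1 , n , sym (*-identityˡ n) , kPowerful[1] (suc j) , free
  ... | inj₁ (p , pp , p^k∣n) =
    subst (PowerfulFactorisation (suc j)) (sym (m∣n⇒n≡m*quotient p^k∣n))
      (powerfulFactorisation-prime^* {suc j} pp (go n′ {{quotient≢0 p^k∣n}} (smaller n′<n)))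
    where
    n′ = quotient p^k∣n
    n′<n : n′ < n
    n′<n = quotient-< p^k∣n {{prime^-nonTrivial j pp}}

rad≢0 : ∀ m → NonZero (rad m)
rad≢0 m = productOfPrimes≢0 (All.map proj₁ (all-filter (λ p → prime? p ×-dec p ∣? m) (upTo (suc m))))

prime∣⇒∣rad : ∀ {m p} .{{_ : NonZero m}} → Prime p → p ∣ m → p ∣ rad m
prime∣⇒∣rad {m} pp p∣m =
  ∈⇒∣product (∈-filter⁺ (λ p → prime? p ×-dec p ∣? m) (∈-upTo⁺ (s≤s (∣⇒≤ p∣m))) (pp , p∣m))

toℚ≡mkℚ : ∀ n → toℚ n ≡ ℚ.mkℚ (+ n) 0 (Coprimality.sym (Coprimality.1-coprimeTo n))
toℚ≡mkℚ n = ℚ.normalize-coprime _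

toℚ-homo-* : ∀ m n → toℚ (m * n) ≡ toℚ m *ℚ toℚ n
toℚ-homo-* m n = trans (cong (ℚ._/ 1) (ℤ.pos-* m n)) (sym (cong₂ _*ℚ_ (toℚ≡mkℚ m) (toℚ≡mkℚ n)))

toℚ-mono-≤ : ∀ {m n} → m ≤ n → toℚ m ≤ℚ toℚ n
toℚ-mono-≤ {m} {n} m≤n =
  subst₂ _≤ℚ_ (sym (toℚ≡mkℚ m)) (sym (toℚ≡mkℚ n)) (ℚ.*≤* (ℤ.*-monoʳ-≤-nonNeg (+ 1) (+≤+ m≤n)))

toℚ-nonNeg : ∀ n → ℚ.NonNegative (toℚ n)
toℚ-nonNeg n = ℚ.normalize-nonNeg n 1

toℚ-pos : ∀ n .{{_ : NonZero n}} → ℚ.Positive (toℚ n)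
toℚ-pos n = ℚ.normalize-pos n 1

KPowerfulDivisorIn : ℕ → ℕ → ℚ → ℚ → Set
KPowerfulDivisorIn k m x y = ∃[ d ] (d ∣ m × KPowerful k d × x ≤ℚ toℚ d × toℚ d ≤ℚ y)

module _ {m c k : ℕ} .{{_ : NonZero m}} .{{_ : NonZero c}} (primes∣c : ∀ p → Prime p → p ∣ m → p ∣ c)
         (x : ℚ) (c^k≤cx : toℚ (c ^ k) ≤ℚ toℚ c *ℚ x) where

  descend : ∀ d → Acc _<_ d → d ∣ m → KPowerful k d → x ≤ℚ toℚ d →
            KPowerfulDivisorIn k m x (toℚ c *ℚ x)
  descend d (acc smaller) d∣m kPd x≤d
    with toℚ d ℚ.≤? toℚ c *ℚ x | primePower∣⊎powerFree k d {{divisor≢0 d∣m}}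
  ... | yes d≤cx | _ = d , d∣m , kPd , x≤d , d≤cx
  ... | no _ | inj₂ free = d , d∣m , kPd , x≤d , ℚ.≤-trans (toℚ-mono-≤ d≤c^k) c^k≤cx
    where
    instance _ = divisor≢0 d∣m
    d≤c^k : d ≤ c ^ k
    d≤c^k = ∣⇒≤ {{m^n≢0 c k}} (powerFree⇒∣^ k free λ p pp p∣d → primes∣c p pp (∣-trans p∣d d∣m))
  ... | no d≰cx | inj₁ (p , pp , p^k+1∣d) =
    descend d′ (smaller d′<d) (∣-trans (quotient-∣ p∣d) d∣m) kPd′ (ℚ.<⇒≤ x<d′)
    where
    instance _ = divisor≢0 d∣m
    p∣d : p ∣ d
    p∣d = ∣-trans (m∣m*n (p ^ k)) p^k+1∣d
    d′ = quotient p∣d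
    d≡pd′ : d ≡ p * d′
    d≡pd′ = m∣n⇒n≡m*quotient p∣d
    d′<d : d′ < d
    d′<d = quotient-< p∣d {{prime⇒nonTrivial pp}}
    kPd′ : KPowerful k d′
    kPd′ = kPowerful-cancelˡ {k} pp (subst (p ^ suc k ∣_) d≡pd′ p^k+1∣d) (subst (KPowerful k) d≡pd′ kPd)
    p≤c : p ≤ c
    p≤c = ∣⇒≤ (primes∣c p pp (∣-trans p∣d d∣m))
    x<d′ : x ℚ.< toℚ d′
    x<d′ = ℚ.*-cancelˡ-<-nonNeg (toℚ c) {{toℚ-nonNeg c}} (begin-strict
      toℚ c *ℚ x       <⟨ ℚ.≰⇒> d≰cx ⟩
      toℚ d            ≡⟨ cong toℚ d≡pd′ ⟩
      toℚ (p * d′)     ≡⟨ toℚ-homo-* p d′ ⟩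
      toℚ p *ℚ toℚ d′  ≤⟨ ℚ.*-monoʳ-≤-nonNeg (toℚ d′) {{toℚ-nonNeg d′}} (toℚ-mono-≤ p≤c) ⟩
      toℚ c *ℚ toℚ d′  ∎)
      where open ℚ.≤-Reasoning

kPowerfulDivisorIn[x,cx] : ∀ {m c} j .{{_ : NonZero m}} .{{_ : NonZero c}} →
  (∀ p → Prime p → p ∣ m → p ∣ c) → (x : ℚ) → toℚ (c ^ j) ≤ℚ x → x *ℚ toℚ (c ^ j) ≤ℚ toℚ m →
  KPowerfulDivisorIn (suc j) m x (toℚ c *ℚ x)
kPowerfulDivisorIn[x,cx] {m} {c} j primes∣c x c^j≤x xc^j≤m
  with D , e , m≡De , kPD , free ← powerfulFactorisation j m =
  descend {k = suc j} primes∣c x c^k≤cx D (<-wellFounded D) D∣m kPD x≤D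
  where
  open ℚ.≤-Reasoning
  D∣m : D ∣ m
  D∣m = divides e (trans m≡De (*-comm D e))
  e∣m : e ∣ m
  e∣m = divides D m≡De
  e≤c^j : e ≤ c ^ j
  e≤c^j = ∣⇒≤ {{m^n≢0 c j}}
    (powerFree⇒∣^ j {{divisor≢0 e∣m}} free λ p pp p∣e → primes∣c p pp (∣-trans p∣e e∣m))
  c^k≤cx : toℚ (c ^ suc j) ≤ℚ toℚ c *ℚ x
  c^k≤cx = begin
    toℚ (c * c ^ j)      ≡⟨ toℚ-homo-* c (c ^ j) ⟩
    toℚ c *ℚ toℚ (c ^ j) ≤⟨ ℚ.*-monoˡ-≤-nonNeg (toℚ c) {{toℚ-nonNeg c}} c^j≤x ⟩
    toℚ c *ℚ x           ∎
  x≤D : x ≤ℚ toℚ D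
  x≤D = ℚ.*-cancelʳ-≤-pos (toℚ (c ^ j)) {{toℚ-pos (c ^ j) {{m^n≢0 c j}}}} (begin
    x *ℚ toℚ (c ^ j)     ≤⟨ xc^j≤m ⟩
    toℚ m                ≡⟨ cong toℚ m≡De ⟩
    toℚ (D * e)          ≡⟨ toℚ-homo-* D e ⟩
    toℚ D *ℚ toℚ e       ≤⟨ ℚ.*-monoˡ-≤-nonNeg (toℚ D) {{toℚ-nonNeg D}} (toℚ-mono-≤ e≤c^j) ⟩
    toℚ D *ℚ toℚ (c ^ j) ∎)

lemma6p1 : (m k : ℕ) → 2 ≤ m → 2 ≤ k →
    rad m ^ (2 * k ∸ 2) ≤ m →
    (x : ℚ) → toℚ (rad m ^ (k ∸ 1)) ≤ℚ x → x *ℚ toℚ (rad m ^ (k ∸ 1)) ≤ℚ toℚ m →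
    ∃[ d ] (d ∣ m × KPowerful k d × x ≤ℚ toℚ d × toℚ d ≤ℚ toℚ (rad m) *ℚ x)
lemma6p1 m zero    _   ()
lemma6p1 m (suc j) 2≤m _ _ = kPowerfulDivisorIn[x,cx] j (λ _ → prime∣⇒∣rad)
  where
  instance
    m≢0 : NonZero m
    m≢0 = >-nonZero (≤-trans (s≤s z≤n) 2≤m)
    rad[m]≢0 : NonZero (rad m)
    rad[m]≢0 = rad≢0 m
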